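{- Let $n\ge k\ge 1$ be integers and let $\eta=(p_1,\dots,p_k)$ be a $k$-partition of $n$. For each arc $(u,v)$ of the multidigraph $D_\eta$, there exist two dicycles in $D_\eta$ containing $(u,v)$ that share only this arc.
   Context: A $k$-partition of $n$ is a $k$-tuple $(p_1,\dots,p_k)$ of integers with $p_i\ge 1$ and $\sum p_i=n$. The multidigraph $D_\eta$ has vertex set $\bigcup_{i=1}^k\{v^i_1,\dots,v^i_{p_i}\}$ and arcs as follows. If $k=1$: arcs $(v^1_i,v^1_{i+1})$ and $(v^1_{i+1},v^1_i)$ for each $i=1,\dots,n$, with $v^1_{n+1}=v^1_1$. If $k\ge 2$: (1) arcs $(v^i_j,v^i_{j+1})$ and $(v^i_{j+1},v^i_j)$ for all $1\le i\le k$, $1\le j\le p_i-1$; (2) arcs $(v^i_1,v^{i+1}_1)$ and $(v^i_{p_i},v^{i+1}_{p_{i+1}})$ for all $1\le i\le k$, where $v^{k+1}_1=v^1_1$ and $v^{k+1}_{p_{k+1}}=v^1_{p_1}$. Arcs added in different steps are distinct even if they have the same tail and head (so $D_\eta$ may have parallel arcs). -}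

module Defs where

open import Data.Nat using (ℕ; zero; suc; _∸_; _≡ᵇ_)
open import Data.Nat.DivMod using (_%_; m%n<n)
open import Data.Fin using (Fin; zero; suc; toℕ; fromℕ<)
open import Data.Product using (Σ; Σ-syntax; ∃-syntax; _×_; _,_)
open import Data.Bool using (if_then_else_)
open import Data.Empty using (⊥)
open import Relation.Binary.PropositionalEquality using (_≡_)
open import Function.Definitions using (Injective)

next : ∀ {k} → Fin k → Fin k
next {suc m} i = fromℕ< (m%n<n (suc (toℕ i)) (suc m))

cyc : ℕ → ℕ → ℕ
cyc n x = if suc x ≡ᵇ n then 0 else suc x

-- Vertices of D_η: v^i_j is represented 0-indexed as (i , j) with i : Fin k
-- and j < p i (all arc endpoints below are such valid pairs).
Vertex : (k : ℕ) → Set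
Vertex k = Fin k × ℕ

-- Arcs for k = 1 (n = p₁): fwd j = (v_{j+1}, v_{j+2}), bwd j = (v_{j+2}, v_{j+1})
-- (1-indexed, cyclically), for j = 0,…,n-1.
data Arc₁ (n : ℕ) : Set where
  fwd bwd : Fin n → Arc₁ n

-- Arcs for k ≥ 2:
--  inF i j = (v^i_{j+1}, v^i_{j+2}), inB i j = (v^i_{j+2}, v^i_{j+1}) for j < p_i - 1   (step 1)
--  top i = (v^i_1, v^{i+1}_1), bot i = (v^i_{p_i}, v^{i+1}_{p_{i+1}})                  (step 2)
data Arc₂ (k : ℕ) (p : Fin k → ℕ) : Set where
  inF inB : (i : Fin k) → Fin (p i ∸ 1) → Arc₂ k p
  top bot : Fin k → Arc₂ k p

-- Arcs of the multidigraph D_η (η = p a k-partition); distinct constructors /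
-- indices give distinct (possibly parallel) arcs.
Arc : (k : ℕ) → (Fin k → ℕ) → Set
Arc zero p = ⊥
Arc (suc zero) p = Arc₁ (p zero)
Arc (suc (suc m)) p = Arc₂ (suc (suc m)) p

tl : ∀ {k} {p : Fin k → ℕ} → Arc k p → Vertex k
tl {suc zero} {p} (fwd j) = zero , toℕ j
tl {suc zero} {p} (bwd j) = zero , cyc (p zero) (toℕ j)
tl {suc (suc m)} (inF i j) = i , toℕ j
tl {suc (suc m)} (inB i j) = i , suc (toℕ j)
tl {suc (suc m)} (top i) = i , 0
tl {suc (suc m)} {p} (bot i) = i , p i ∸ 1

hd : ∀ {k} {p : Fin k → ℕ} → Arc k p → Vertex k
hd {suc zero} {p} (fwd j) = zero , cyc (p zero) (toℕ j)
hd {suc zero} {p} (bwd j) = zero , toℕ j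
hd {suc (suc m)} (inF i j) = i , suc (toℕ j)
hd {suc (suc m)} (inB i j) = i , toℕ j
hd {suc (suc m)} (top i) = next i , 0
hd {suc (suc m)} {p} (bot i) = next i , p (next i) ∸ 1

-- A dicycle: arcs e_0,…,e_{len-1} (len ≥ 1) with head(e_t) = tail(e_{t+1 mod len})
-- and pairwise distinct tails (i.e. distinct vertices).
record Dicycle (k : ℕ) (p : Fin k → ℕ) : Set where
  field
    len    : ℕ
    arc    : Fin (suc len) → Arc k p
    closed : ∀ t → hd (arc t) ≡ tl (arc (next t))
    simple : Injective _≡_ _≡_ (λ t → tl (arc t))
open Dicycle public

_∋ₐ_ : ∀ {k p} → Dicycle k p → Arc k p → Set
C ∋ₐ a = ∃[ t ] arc C t ≡ a

ShareOnly : ∀ {k p} → Dicycle k p → Dicycle k p → Arc k p → Set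
ShareOnly C₁ C₂ a = ∀ s t → arc C₁ s ≡ arc C₂ t → arc C₁ s ≡ a

{-# OPTIONS --safe #-}
-- For k = 1, D_η is a cycle traversable in both directions: an arc lies on the
-- dicycle running once around in its direction and on the digon formed with
-- its reverse arc, and these two share only that arc (with a single vertex,
-- the arc is a loop and serves as both dicycles).
--
-- For k ≥ 2, reflecting every block (v^i_j ↦ v^i_{p_i+1-j}) swaps top with
-- bottom arcs and the two directions inside blocks, so both sides are handled
-- alike. For a block i with successor c, the upper detour takes the top
-- arc from i to c, climbs down block c, runs along the bottom arcs from c
-- all the way round to i and climbs up block i. Its only top arc is the one
-- leaving i, and it uses no downward arc of block i. So the top arc leaving i
-- lies on the dicycle of all top arcs and on the upper detour of i, and an
-- upward arc of block i lies on the digon with the downward arc beside it and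
-- on the upper detour of i; the lower side is symmetric. The vertices of a detour are distinct
-- because their position along it increases strictly at every arc except the
-- closing one.
module Submission where

open import Defs
open import Data.Nat using (ℕ; zero; suc; _+_; _∸_; _≤_; _<_; _≡ᵇ_; _≟_; _≤?_; z≤n; s≤s; s≤s⁻¹)
open import Data.Nat.Properties
open import Data.Nat.DivMod using (_%_; %-distribˡ-+; m%n%n≡m%n; [m+n]%n≡m%n; m<n⇒m%n≡m; n%n≡0)
open import Data.Fin using (Fin; zero; suc; toℕ; fromℕ; inject₁; opposite; cast)
open import Data.Fin.Properties using (toℕ-injective; toℕ-fromℕ<; toℕ-fromℕ; toℕ-inject₁; inject₁ℕ<; toℕ<n; toℕ-cast; cast-involutive; opposite-prop; opposite-involutive)
open import Data.List using (List; []; _∷_; _++_; length; lookup; tabulate)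
open import Data.List.Membership.Propositional using (_∈_)
open import Data.List.Membership.Propositional.Properties using (∈-lookup; ∈-++⁻; ∈-++⁺ʳ; ∈-tabulate⁺; ∈-tabulate⁻)
open import Data.List.Relation.Unary.All as All using (All; []; _∷_)
open import Data.List.Relation.Unary.All.Properties using (++⁺)
open import Data.List.Relation.Unary.Any using (here; there; index)
open import Data.List.Relation.Unary.Any.Properties using (lookup-index)
open import Data.Nat.ListAction using (sum)
open import Data.Product using (Σ-syntax; ∃-syntax; _×_; _,_; proj₁; proj₂)
open import Data.Sum using (_⊎_; inj₁; inj₂)
open import Data.Bool using (true; false; T)
open import Data.Unit using (tt)
open import Function using (_∘_)
open import Function.Definitions using (Injective)
open import Relation.Nullary using (¬_; yes; no; contradiction)
open import Relation.Binary.PropositionalEquality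
open import Relation.Binary.Construct.Closure.ReflexiveTransitive using (Star; ε; _◅_; _◅◅_)
open ≡-Reasoning

fromℕ-or-inject₁ : ∀ {n} (t : Fin (suc n)) → t ≡ fromℕ n ⊎ ∃[ t′ ] t ≡ inject₁ t′
fromℕ-or-inject₁ {zero} zero = inj₁ refl
fromℕ-or-inject₁ {suc n} zero = inj₂ (zero , refl)
fromℕ-or-inject₁ {suc n} (suc t) with fromℕ-or-inject₁ t
... | inj₁ t≡last = inj₁ (cong suc t≡last)
... | inj₂ (t′ , t≡t′) = inj₂ (suc t′ , cong suc t≡t′)

toℕ-next : ∀ {n} (t : Fin (suc n)) → toℕ (next t) ≡ suc (toℕ t) % suc n
toℕ-next t = toℕ-fromℕ< _

next-fromℕ : ∀ n → next (fromℕ n) ≡ zero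
next-fromℕ n = toℕ-injective (begin
  toℕ (next (fromℕ n))        ≡⟨ toℕ-next (fromℕ n) ⟩
  suc (toℕ (fromℕ n)) % suc n ≡⟨ cong (λ x → suc x % suc n) (toℕ-fromℕ n) ⟩
  suc n % suc n               ≡⟨ n%n≡0 (suc n) ⟩
  0                           ∎)

next-inject₁ : ∀ {n} (t : Fin n) → next (inject₁ t) ≡ suc t
next-inject₁ {n} t = toℕ-injective (begin
  toℕ (next (inject₁ t))        ≡⟨ toℕ-next (inject₁ t) ⟩
  suc (toℕ (inject₁ t)) % suc n ≡⟨ cong (λ x → suc x % suc n) (toℕ-inject₁ t) ⟩
  suc (toℕ t) % suc n           ≡⟨ m<n⇒m%n≡m (s≤s (toℕ<n t)) ⟩
  suc (toℕ t)                   ∎)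

module Dicycles {k : ℕ} {p : Fin k → ℕ} where

  DicyclePair : Arc k p → Set
  DicyclePair a = Σ[ C₁ ∈ Dicycle k p ] Σ[ C₂ ∈ Dicycle k p ] (C₁ ∋ₐ a) × (C₂ ∋ₐ a) × ShareOnly C₁ C₂ a

  meetingOnlyAt : ∀ {a} (C₁ C₂ : Dicycle k p) → C₁ ∋ₐ a → C₂ ∋ₐ a →
                  (∀ {x} → C₁ ∋ₐ x → C₂ ∋ₐ x → x ≡ a) → DicyclePair a
  meetingOnlyAt C₁ C₂ a∈C₁ a∈C₂ common =
    C₁ , C₂ , a∈C₁ , a∈C₂ , λ s t eq → common (s , refl) (t , sym eq)

  digon : (a b : Arc k p) → hd a ≡ tl b → hd b ≡ tl a → tl a ≢ tl b → Dicycle k p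
  digon a b ab ba a≢b = record { len = 1 ; arc = arc₂ ; closed = closed₂ ; simple = simple₂ }
    where
    arc₂ : Fin 2 → Arc k p
    arc₂ zero = a
    arc₂ (suc zero) = b
    closed₂ : ∀ t → hd (arc₂ t) ≡ tl (arc₂ (next t))
    closed₂ zero = ab
    closed₂ (suc zero) = ba
    simple₂ : Injective _≡_ _≡_ (tl ∘ arc₂)
    simple₂ {zero} {zero} _ = refl
    simple₂ {zero} {suc zero} eq = contradiction eq a≢b
    simple₂ {suc zero} {zero} eq = contradiction (sym eq) a≢b
    simple₂ {suc zero} {suc zero} _ = refl

  digonPair : ∀ a b (ab : hd a ≡ tl b) (ba : hd b ≡ tl a) (a≢b : tl a ≢ tl b) (C : Dicycle k p) →
              C ∋ₐ a → ¬ C ∋ₐ b → DicyclePair a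
  digonPair a b ab ba a≢b C a∈C b∉C = meetingOnlyAt (digon a b ab ba a≢b) C (zero , refl) a∈C common
    where
    common : ∀ {x} → digon a b ab ba a≢b ∋ₐ x → C ∋ₐ x → x ≡ a
    common (zero , refl) _ = refl
    common (suc zero , refl) b∈C = contradiction b∈C b∉C

  Step : Vertex k → Vertex k → Set
  Step u v = Σ[ a ∈ Arc k p ] tl a ≡ u × hd a ≡ v

  Path : Vertex k → Vertex k → Set
  Path = Star Step

  arcs : ∀ {u v} → Path u v → List (Arc k p)
  arcs ε = []
  arcs ((a , _) ◅ w) = a ∷ arcs w

  arcs-◅◅ : ∀ {u v x} (w : Path u v) (w′ : Path v x) → arcs (w ◅◅ w′) ≡ arcs w ++ arcs w′
  arcs-◅◅ ε w′ = refl
  arcs-◅◅ ((a , _) ◅ w) w′ = cong (a ∷_) (arcs-◅◅ w w′)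

  arcs-subst : ∀ {u v v′} (eq : v ≡ v′) (w : Path u v) → arcs (subst (Path u) eq w) ≡ arcs w
  arcs-subst refl w = refl

  chain : ∀ {n} (v : ℕ → Vertex k) (f : Fin n → Arc k p) →
          (∀ j → tl (f j) ≡ v (toℕ j)) → (∀ j → hd (f j) ≡ v (suc (toℕ j))) → Path (v 0) (v n)
  chain {zero} v f tl≡ hd≡ = ε
  chain {suc n} v f tl≡ hd≡ = (f zero , tl≡ zero , hd≡ zero) ◅ chain (v ∘ suc) (f ∘ suc) (tl≡ ∘ suc) (hd≡ ∘ suc)

  arcs-chain : ∀ {n} v (f : Fin n → Arc k p) tl≡ hd≡ → arcs (chain v f tl≡ hd≡) ≡ tabulate f
  arcs-chain {zero} v f tl≡ hd≡ = refl
  arcs-chain {suc n} v f tl≡ hd≡ = cong (f zero ∷_) (arcs-chain (v ∘ suc) (f ∘ suc) (tl≡ ∘ suc) (hd≡ ∘ suc))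

  Ascends : (Vertex k → ℕ) → Arc k p → Set
  Ascends r a = r (tl a) < r (hd a)

  Ascending : ∀ {u v} → (Vertex k → ℕ) → Path u v → Set
  Ascending r w = All (Ascends r) (arcs w)

  module _ {r : Vertex k → ℕ} where

    ascending-≤ : ∀ {u v} (w : Path u v) → Ascending r w → r u ≤ r v
    ascending-≤ ε [] = ≤-refl
    ascending-≤ ((a , refl , refl) ◅ w) (a↑ ∷ w↑) = <⇒≤ (<-≤-trans a↑ (ascending-≤ w w↑))

    tails-between : ∀ {u v} (w : Path u v) → Ascending r w → ∀ t →
                    r u ≤ r (tl (lookup (arcs w) t)) × r (tl (lookup (arcs w) t)) < r v
    tails-between ((a , refl , refl) ◅ w) (a↑ ∷ w↑) zero = ≤-refl , <-≤-trans a↑ (ascending-≤ w w↑)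
    tails-between ((a , refl , refl) ◅ w) (a↑ ∷ w↑) (suc t) with tails-between w w↑ t
    ... | lo , hi = ≤-trans (<⇒≤ a↑) lo , hi

    tails-injective : ∀ {u v} (w : Path u v) → Ascending r w → Injective _≡_ _≡_ (tl ∘ lookup (arcs w))
    tails-injective ((a , refl , refl) ◅ w) (a↑ ∷ w↑) {zero} {zero} _ = refl
    tails-injective ((a , refl , refl) ◅ w) (a↑ ∷ w↑) {zero} {suc t} eq =
      contradiction (cong r eq) (<⇒≢ (<-≤-trans a↑ (proj₁ (tails-between w w↑ t))))
    tails-injective ((a , refl , refl) ◅ w) (a↑ ∷ w↑) {suc s} {zero} eq =
      contradiction (cong r eq) (>⇒≢ (<-≤-trans a↑ (proj₁ (tails-between w w↑ s))))
    tails-injective ((a , refl , refl) ◅ w) (a↑ ∷ w↑) {suc s} {suc t} eq =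
      cong suc (tails-injective w w↑ eq)

  hd-last : ∀ {a u v} → hd a ≡ u → (w : Path u v) → hd (lookup (a ∷ arcs w) (fromℕ (length (arcs w)))) ≡ v
  hd-last a≡ ε = a≡
  hd-last a≡ ((b , refl , refl) ◅ w) = hd-last refl w

  linked : ∀ {a u v} → hd a ≡ u → (w : Path u v) (t : Fin (length (arcs w))) →
           hd (lookup (a ∷ arcs w) (inject₁ t)) ≡ tl (lookup (arcs w) t)
  linked a≡ ((b , refl , refl) ◅ w) zero = a≡
  linked a≡ ((b , refl , refl) ◅ w) (suc t) = linked refl w t

  -- The tails of w have distinct potentials r, all below r v, which is the
  -- potential of the closing arc's tail.
  toDicycle : ∀ {u v} (r : Vertex k → ℕ) → Step v u → (w : Path u v) → Ascending r w → Dicycle k p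
  toDicycle r (a , tl≡ , hd≡) w w↑ =
    record { len = length (arcs w) ; arc = lookup (a ∷ arcs w) ; closed = closed′ ; simple = simple′ }
    where
    closed′ : ∀ t → hd (lookup (a ∷ arcs w) t) ≡ tl (lookup (a ∷ arcs w) (next t))
    closed′ t with fromℕ-or-inject₁ t
    ... | inj₁ refl = trans (hd-last hd≡ w) (trans (sym tl≡) (cong (tl ∘ lookup (a ∷ arcs w)) (sym (next-fromℕ _))))
    ... | inj₂ (t′ , refl) = trans (linked hd≡ w t′) (cong (tl ∘ lookup (a ∷ arcs w)) (sym (next-inject₁ t′)))
    simple′ : Injective _≡_ _≡_ (tl ∘ lookup (a ∷ arcs w))
    simple′ {zero} {zero} _ = refl
    simple′ {zero} {suc t} eq = contradiction (cong r (trans (sym tl≡) eq)) (>⇒≢ (proj₂ (tails-between w w↑ t)))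
    simple′ {suc s} {zero} eq = contradiction (cong r (trans eq tl≡)) (<⇒≢ (proj₂ (tails-between w w↑ s)))
    simple′ {suc s} {suc t} eq = cong suc (tails-injective {r = r} w w↑ eq)

  ∋-toDicycle⁻ : ∀ {u v} r (a : Step v u) w w↑ {x} → toDicycle r a w w↑ ∋ₐ x → x ∈ proj₁ a ∷ arcs w
  ∋-toDicycle⁻ r a w w↑ (t , refl) = ∈-lookup t

  ∋-toDicycle⁺ : ∀ {u v} r (a : Step v u) w w↑ {x} → x ∈ proj₁ a ∷ arcs w → toDicycle r a w w↑ ∋ₐ x
  ∋-toDicycle⁺ r a w w↑ x∈ = index x∈ , sym (lookup-index x∈)

next-opposite-next : ∀ {n} (t : Fin (suc n)) → next (opposite (next t)) ≡ opposite t
next-opposite-next {n} t with fromℕ-or-inject₁ t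
... | inj₁ refl = begin
  next (opposite (next (fromℕ n))) ≡⟨ cong (next ∘ opposite) (next-fromℕ n) ⟩
  next (fromℕ n)                   ≡⟨ next-fromℕ n ⟩
  zero                             ≡⟨ toℕ-injective (trans (opposite-prop (fromℕ n)) (trans (cong (n ∸_) (toℕ-fromℕ n)) (n∸n≡0 n))) ⟨
  opposite (fromℕ n)               ∎
... | inj₂ (t′ , refl) = begin
  next (opposite (next (inject₁ t′))) ≡⟨ cong (next ∘ opposite) (next-inject₁ t′) ⟩
  next (inject₁ (opposite t′))        ≡⟨ next-inject₁ (opposite t′) ⟩
  suc (opposite t′)                   ≡⟨ toℕ-injective toℕ-eq ⟩
  opposite (inject₁ t′)               ∎
  where
  toℕ-eq : suc (toℕ (opposite t′)) ≡ toℕ (opposite (inject₁ t′))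
  toℕ-eq = begin
    suc (toℕ (opposite t′))     ≡⟨ cong suc (opposite-prop t′) ⟩
    suc (n ∸ suc (toℕ t′))      ≡⟨ +-∸-assoc 1 (toℕ<n t′) ⟨
    n ∸ toℕ t′                  ≡⟨ cong (n ∸_) (toℕ-inject₁ t′) ⟨
    n ∸ toℕ (inject₁ t′)        ≡⟨ opposite-prop (inject₁ t′) ⟨
    toℕ (opposite (inject₁ t′)) ∎

opposite-injective : ∀ {n} → Injective {A = Fin n} _≡_ _≡_ opposite
opposite-injective {x = s} {t} eq = begin
  s                     ≡⟨ opposite-involutive s ⟨
  opposite (opposite s) ≡⟨ cong opposite eq ⟩
  opposite (opposite t) ≡⟨ opposite-involutive t ⟩
  t                     ∎

next-injective : ∀ {n} → Injective {A = Fin (suc n)} _≡_ _≡_ next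
next-injective {x = s} {t} eq = opposite-injective (begin
  opposite s                   ≡⟨ next-opposite-next s ⟨
  next (opposite (next s))     ≡⟨ cong (next ∘ opposite) eq ⟩
  next (opposite (next t))     ≡⟨ next-opposite-next t ⟩
  opposite t                   ∎)

cyc-wrap : ∀ {n x} → suc x ≡ n → cyc n x ≡ 0
cyc-wrap {n} {x} sx≡n with suc x ≡ᵇ n in eq
... | true = refl
... | false = contradiction (subst T eq (≡⇒≡ᵇ (suc x) n sx≡n)) λ ()

cyc-suc : ∀ {n x} → suc x ≢ n → cyc n x ≡ suc x
cyc-suc {n} {x} sx≢n with suc x ≡ᵇ n in eq
... | true = contradiction (≡ᵇ⇒≡ (suc x) n (subst T (sym eq) tt)) sx≢n
... | false = refl

cyc-toℕ : ∀ {n} (t : Fin (suc n)) → cyc (suc n) (toℕ t) ≡ toℕ (next t)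
cyc-toℕ {n} t with fromℕ-or-inject₁ t
... | inj₁ refl = begin
  cyc (suc n) (toℕ (fromℕ n)) ≡⟨ cyc-wrap (cong suc (toℕ-fromℕ n)) ⟩
  0                           ≡⟨ cong toℕ (next-fromℕ n) ⟨
  toℕ (next (fromℕ n))        ∎
... | inj₂ (t′ , refl) = begin
  cyc (suc n) (toℕ (inject₁ t′)) ≡⟨ cyc-suc (<⇒≢ (s≤s (inject₁ℕ< t′))) ⟩
  suc (toℕ (inject₁ t′))         ≡⟨ cong suc (toℕ-inject₁ t′) ⟩
  toℕ (suc t′)                   ≡⟨ cong toℕ (next-inject₁ t′) ⟨
  toℕ (next (inject₁ t′))        ∎

cyc-≢ : ∀ {n x} → 2 ≤ n → cyc n x ≢ x
cyc-≢ {n} {x} 2≤n with suc x ≟ n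
... | yes sx≡n = λ eq → 1+n≰n (subst (2 ≤_) (trans (sym sx≡n) (cong suc (trans (sym eq) (cyc-wrap sx≡n)))) 2≤n)
... | no sx≢n = λ eq → 1+n≢n (trans (sym (cyc-suc sx≢n)) eq)

data Orientation : Set where
  forward backward : Orientation

reverse : Orientation → Orientation
reverse forward = backward
reverse backward = forward

module OneBlock (p : Fin 1 → ℕ) (n : ℕ) (p≡ : p zero ≡ suc n) where

  open Dicycles {1} {p}

  arrow : Orientation → Fin (p zero) → Arc 1 p
  arrow forward = fwd
  arrow backward = bwd

  arrow-meets : ∀ s {j} → hd {p = p} (arrow s j) ≡ tl {p = p} (arrow (reverse s) j)
  arrow-meets forward = refl
  arrow-meets backward = refl

  arrow-returns : ∀ s {j} → hd {p = p} (arrow (reverse s) j) ≡ tl {p = p} (arrow s j)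
  arrow-returns forward = refl
  arrow-returns backward = refl

  arrow-tails-differ : 2 ≤ p zero → ∀ s {j} → tl {p = p} (arrow s j) ≢ tl {p = p} (arrow (reverse s) j)
  arrow-tails-differ 2≤p forward eq = cyc-≢ 2≤p (sym (cong proj₂ eq))
  arrow-tails-differ 2≤p backward eq = cyc-≢ 2≤p (cong proj₂ eq)

  arrow≢reverse-arrow : ∀ s {j j′} → arrow s j ≢ arrow (reverse s) j′
  arrow≢reverse-arrow forward ()
  arrow≢reverse-arrow backward ()

  position : Fin (suc n) → Fin (p zero)
  position = cast (sym p≡)

  toℕ-position : ∀ u → toℕ (position u) ≡ toℕ u
  toℕ-position = toℕ-cast (sym p≡)

  cyc-position : ∀ u → cyc (p zero) (toℕ (position u)) ≡ toℕ (next u)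
  cyc-position u = trans (cong₂ cyc p≡ (toℕ-position u)) (cyc-toℕ u)

  tour : Orientation → Dicycle 1 p
  tour forward = record
    { len = n
    ; arc = fwd ∘ position
    ; closed = λ t → cong (zero ,_) (trans (cyc-position t) (sym (toℕ-position (next t))))
    ; simple = λ eq → toℕ-injective (trans (sym (toℕ-position _)) (trans (cong proj₂ eq) (toℕ-position _)))
    }
  tour backward = record
    { len = n
    ; arc = bwd ∘ position ∘ opposite
    ; closed = λ t → cong (zero ,_) (begin
        toℕ (position (opposite t))                       ≡⟨ toℕ-position (opposite t) ⟩
        toℕ (opposite t)                                  ≡⟨ cong toℕ (next-opposite-next t) ⟨
        toℕ (next (opposite (next t)))                    ≡⟨ cyc-position (opposite (next t)) ⟨
        cyc (p zero) (toℕ (position (opposite (next t)))) ∎)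
    ; simple = λ {s} {t} eq → opposite-injective (next-injective (toℕ-injective
        (trans (sym (cyc-position (opposite s))) (trans (cong proj₂ eq) (cyc-position (opposite t))))))
    }

  tour-∋ : ∀ s j → tour s ∋ₐ arrow s j
  tour-∋ forward j = cast p≡ j , cong fwd (cast-involutive (sym p≡) p≡ j)
  tour-∋ backward j = opposite (cast p≡ j) ,
    cong bwd (trans (cong position (opposite-involutive (cast p≡ j))) (cast-involutive (sym p≡) p≡ j))

  ∋-tour : ∀ s {x} → tour s ∋ₐ x → ∃[ j ] x ≡ arrow s j
  ∋-tour forward (t , refl) = _ , refl
  ∋-tour backward (t , refl) = _ , refl

  pairAtArrow : ∀ s j → DicyclePair (arrow s j)
  pairAtArrow s j with 2 ≤? p zero
  ... | yes 2≤p = digonPair (arrow s j) (arrow (reverse s) j) (arrow-meets s) (arrow-returns s) (arrow-tails-differ 2≤p s)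
    (tour s) (tour-∋ s j) (λ b∈tour → arrow≢reverse-arrow s (sym (proj₂ (∋-tour s b∈tour))))
  ... | no 2≰p = meetingOnlyAt (tour s) (tour s) (tour-∋ s j) (tour-∋ s j) common
    where
    only-position : ∀ (j′ : Fin (p zero)) → toℕ j′ ≡ 0
    only-position j′ = n<1⇒n≡0 (<-≤-trans (toℕ<n j′) (s≤s⁻¹ (≰⇒> 2≰p)))
    common : ∀ {x} → tour s ∋ₐ x → tour s ∋ₐ x → x ≡ arrow s j
    common x∈ _ with ∋-tour s x∈
    ... | j′ , refl = cong (arrow s) (toℕ-injective (trans (only-position j′) (sym (only-position j))))

  dicyclePair : (a : Arc 1 p) → DicyclePair a
  dicyclePair (fwd j) = pairAtArrow forward j
  dicyclePair (bwd j) = pairAtArrow backward j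

[m+n%d]%d≡[m+n]%d : ∀ m n d → (m + n % suc d) % suc d ≡ (m + n) % suc d
[m+n%d]%d≡[m+n]%d m n d = begin
  (m + n % suc d) % suc d                 ≡⟨ %-distribˡ-+ m (n % suc d) (suc d) ⟩
  (m % suc d + n % suc d % suc d) % suc d ≡⟨ cong (λ x → (m % suc d + x) % suc d) (m%n%n≡m%n n (suc d)) ⟩
  (m % suc d + n % suc d) % suc d         ≡⟨ %-distribˡ-+ m n (suc d) ⟨
  (m + n) % suc d                         ∎

advance : ∀ {k} → ℕ → Fin k → Fin k
advance zero b = b
advance (suc d) b = next (advance d b)

advance-next : ∀ {k} d (b : Fin k) → advance d (next b) ≡ next (advance d b)
advance-next zero b = refl
advance-next (suc d) b = cong next (advance-next d b)

toℕ-advance : ∀ {n} d (b : Fin (suc n)) → toℕ (advance d b) ≡ (d + toℕ b) % suc n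
toℕ-advance zero b = sym (m<n⇒m%n≡m (toℕ<n b))
toℕ-advance {n} (suc d) b = begin
  toℕ (next (advance d b))          ≡⟨ toℕ-next (advance d b) ⟩
  suc (toℕ (advance d b)) % suc n   ≡⟨ cong (λ x → suc x % suc n) (toℕ-advance d b) ⟩
  (1 + (d + toℕ b) % suc n) % suc n ≡⟨ [m+n%d]%d≡[m+n]%d 1 (d + toℕ b) n ⟩
  suc (d + toℕ b) % suc n           ∎

advance-full : ∀ {n} (b : Fin (suc n)) → advance (suc n) b ≡ b
advance-full {n} b = toℕ-injective (begin
  toℕ (advance (suc n) b) ≡⟨ toℕ-advance (suc n) b ⟩
  (suc n + toℕ b) % suc n ≡⟨ cong (_% suc n) (+-comm (suc n) (toℕ b)) ⟩
  (toℕ b + suc n) % suc n ≡⟨ [m+n]%n≡m%n (toℕ b) (suc n) ⟩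
  toℕ b % suc n           ≡⟨ m<n⇒m%n≡m (toℕ<n b) ⟩
  toℕ b                   ∎)

steps : ∀ {n} → Fin (suc n) → Fin (suc n) → ℕ
steps {n} c b = (suc n ∸ toℕ c + toℕ b) % suc n

steps-advance : ∀ {n} (c : Fin (suc n)) {d} → d < suc n → steps c (advance d c) ≡ d
steps-advance {n} c {d} d<N = begin
  (N ∸ toℕ c + toℕ (advance d c)) % N ≡⟨ cong (λ x → (N ∸ toℕ c + x) % N) (toℕ-advance d c) ⟩
  (N ∸ toℕ c + (d + toℕ c) % N) % N   ≡⟨ [m+n%d]%d≡[m+n]%d (N ∸ toℕ c) (d + toℕ c) n ⟩
  (N ∸ toℕ c + (d + toℕ c)) % N       ≡⟨ cong (_% N) N∸c+[d+c]≡d+N ⟩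
  (d + N) % N                         ≡⟨ [m+n]%n≡m%n d N ⟩
  d % N                               ≡⟨ m<n⇒m%n≡m d<N ⟩
  d                                   ∎
  where
  N = suc n
  N∸c+[d+c]≡d+N : N ∸ toℕ c + (d + toℕ c) ≡ d + N
  N∸c+[d+c]≡d+N = begin
    N ∸ toℕ c + (d + toℕ c) ≡⟨ cong (N ∸ toℕ c +_) (+-comm d (toℕ c)) ⟩
    N ∸ toℕ c + (toℕ c + d) ≡⟨ +-assoc (N ∸ toℕ c) (toℕ c) d ⟨
    N ∸ toℕ c + toℕ c + d   ≡⟨ cong (_+ d) (m∸n+n≡m (<⇒≤ (toℕ<n c))) ⟩
    N + d                   ≡⟨ +-comm N d ⟩
    d + N                   ∎

-- The upper side is that of the top arcs, of position 0 in every block, and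
-- of the arcs inF leading away from it.
data Side : Set where
  upper lower : Side

other : Side → Side
other upper = lower
other lower = upper

other-involutive : ∀ s → other (other s) ≡ s
other-involutive upper = refl
other-involutive lower = refl

module ManyBlocks (m : ℕ) (p : Fin (suc (suc m)) → ℕ) where

  K : ℕ
  K = suc (suc m)

  open Dicycles {K} {p}

  end : Side → Fin K → ℕ
  end upper b = 0
  end lower b = p b ∸ 1

  corner : Side → Fin K → Vertex K
  corner s b = b , end s b

  link : Side → Fin K → Arc K p
  link upper = top
  link lower = bot

  rung : (s : Side) (b : Fin K) → Fin (p b ∸ 1) → Arc K p
  rung upper = inF
  rung lower = inB

  depth : Side → Fin K → ℕ → ℕ
  depth upper b y = y
  depth lower b y = p b ∸ 1 ∸ y

  tl-link : ∀ s {b} → tl (link s b) ≡ corner s b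
  tl-link upper = refl
  tl-link lower = refl

  hd-link : ∀ s {b} → hd (link s b) ≡ corner s (next b)
  hd-link upper = refl
  hd-link lower = refl

  depth-end : ∀ s b → depth s b (end s b) ≡ 0
  depth-end upper b = refl
  depth-end lower b = n∸n≡0 (p b ∸ 1)

  depth-other-end : ∀ s b → depth s b (end (other s) b) ≡ p b ∸ 1
  depth-other-end upper b = refl
  depth-other-end lower b = refl

  rung-ascends : ∀ s {b} j (r : Vertex K → ℕ) o → (∀ y → r (b , y) ≡ o + depth s b y) → Ascends r (rung s b j)
  rung-ascends upper j r o r≡ = subst₂ _<_ (sym (r≡ _)) (sym (r≡ _)) (+-monoʳ-< o (n<1+n (toℕ j)))
  rung-ascends lower j r o r≡ = subst₂ _<_ (sym (r≡ _)) (sym (r≡ _)) (+-monoʳ-< o (∸-monoʳ-< (n<1+n (toℕ j)) (toℕ<n j)))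

  rung-meets : ∀ s {b j} → hd (rung (other s) b j) ≡ tl (rung s b j)
  rung-meets upper = refl
  rung-meets lower = refl

  rung-returns : ∀ s {b j} → hd (rung s b j) ≡ tl (rung (other s) b j)
  rung-returns upper = refl
  rung-returns lower = refl

  rung-tails-differ : ∀ s {b j} → tl (rung (other s) b j) ≢ tl (rung s b j)
  rung-tails-differ upper eq = 1+n≢n (cong proj₂ eq)
  rung-tails-differ lower eq = 1+n≢n (sym (cong proj₂ eq))

  link-injective : ∀ s {b b′} → link s b ≡ link s b′ → b ≡ b′
  link-injective upper refl = refl
  link-injective lower refl = refl

  link≢rung : ∀ s s′ {b b′ j} → link s b ≢ rung s′ b′ j
  link≢rung upper upper ()
  link≢rung upper lower ()
  link≢rung lower upper ()
  link≢rung lower lower ()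

  link≢other-link : ∀ s {b b′} → link s b ≢ link (other s) b′
  link≢other-link upper ()
  link≢other-link lower ()

  rung-block : ∀ s {b b′ j j′} → rung s b j ≡ rung s b′ j′ → b ≡ b′
  rung-block upper refl = refl
  rung-block lower refl = refl

  rung≢other-rung : ∀ s {b b′ j j′} → rung s b j ≢ rung (other s) b′ j′
  rung≢other-rung upper ()
  rung≢other-rung lower ()

  descent : (b : Fin K) → Path (corner lower b) (b , p b ∸ 1 ∸ (p b ∸ 1))
  descent b = chain (λ y → b , p b ∸ 1 ∸ y) (rung lower b ∘ opposite) tl≡ hd≡
    where
    tl≡ : ∀ j → tl (rung lower b (opposite j)) ≡ (b , p b ∸ 1 ∸ toℕ j)
    tl≡ j = cong (b ,_) (trans (cong suc (opposite-prop j)) (sym (+-∸-assoc 1 (toℕ<n j))))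
    hd≡ : ∀ j → hd (rung lower b (opposite j)) ≡ (b , p b ∸ 1 ∸ suc (toℕ j))
    hd≡ j = cong (b ,_) (opposite-prop j)

  crossing : (s : Side) (b : Fin K) → Path (corner s b) (corner (other s) b)
  crossing upper b = chain (b ,_) (rung upper b) (λ _ → refl) (λ _ → refl)
  crossing lower b = subst (Path _) (cong (b ,_) (n∸n≡0 (p b ∸ 1))) (descent b)

  ∈-crossing⁻ : ∀ s b {x} → x ∈ arcs (crossing s b) → ∃[ j ] x ≡ rung s b j
  ∈-crossing⁻ upper b x∈ = ∈-tabulate⁻ (subst (_ ∈_) (arcs-chain _ _ _ _) x∈)
  ∈-crossing⁻ lower b x∈ with ∈-tabulate⁻ (subst (_ ∈_) (trans (arcs-subst _ (descent b)) (arcs-chain _ _ _ _)) x∈)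
  ... | j , x≡ = opposite j , x≡

  ∈-crossing⁺ : ∀ s b j → rung s b j ∈ arcs (crossing s b)
  ∈-crossing⁺ upper b j = subst (_ ∈_) (sym (arcs-chain _ _ _ _)) (∈-tabulate⁺ j)
  ∈-crossing⁺ lower b j =
    subst₂ _∈_ (cong (rung lower b) (opposite-involutive j)) (sym (trans (arcs-subst _ (descent b)) (arcs-chain _ _ _ _)))
      (∈-tabulate⁺ (opposite j))

  ring : Side → Dicycle K p
  ring s = record
    { len = suc m
    ; arc = link s
    ; closed = λ t → trans (hd-link s) (sym (tl-link s))
    ; simple = λ eq → cong proj₁ (trans (sym (tl-link s)) (trans eq (tl-link s)))
    }

  link-after : Side → Fin K → Fin (suc m) → Arc K p
  link-after s i d = link s (advance (toℕ d) (next i))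

  around-closes : ∀ i → advance (suc m) (next i) ≡ i
  around-closes i = trans (advance-next (suc m) i) (advance-full {suc m} i)

  links : (s : Side) (i : Fin K) → Path (corner s (next i)) (corner s (advance (suc m) (next i)))
  links s i = chain {n = suc m} (λ d → corner s (advance d (next i))) (link-after s i) (λ _ → tl-link s) (λ _ → hd-link s)

  around : (s : Side) (i : Fin K) → Path (corner s (next i)) (corner s i)
  around s i = subst (Path _) (cong (corner s) (around-closes i)) (links s i)

  ∈-around⁻ : ∀ s i {x} → x ∈ arcs (around s i) → ∃[ d ] d < suc m × x ≡ link s (advance d (next i))
  ∈-around⁻ s i x∈ with ∈-tabulate⁻ (subst (_ ∈_) arcs-around x∈)
    where
    arcs-around : arcs (around s i) ≡ tabulate (link-after s i)
    arcs-around = trans (arcs-subst (cong (corner s) (around-closes i)) (links s i))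
      (arcs-chain (λ d → corner s (advance d (next i))) (link-after s i) (λ _ → tl-link s) (λ _ → hd-link s))
  ... | d , x≡ = toℕ d , toℕ<n d , x≡

  module Detour (s : Side) (i : Fin K) where

    c : Fin K
    c = next i

    width : ℕ
    width = p c ∸ 1

    -- Depth in block c, then one unit per block passed, then depth in block i
    -- measured from the corner where the detour enters it.
    level : ℕ → Fin K → ℕ → ℕ
    level zero b y = depth s c y
    level (suc d) b y = width + suc d + depth (other s) b y

    rank : Vertex K → ℕ
    rank (b , y) = level (steps c b) b y

    rank-level : ∀ {b d} → steps c b ≡ d → ∀ y → rank (b , y) ≡ level d b y
    rank-level steps≡ y = cong (λ d → level d _ y) steps≡

    c-steps : steps c c ≡ 0
    c-steps = steps-advance c (s≤s z≤n)

    i-steps : steps c i ≡ suc m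
    i-steps = trans (cong (steps c) (sym (around-closes i))) (steps-advance c ≤-refl)

    c≢i : c ≢ i
    c≢i c≡i = 0≢1+n (trans (sym c-steps) (trans (cong (steps c) c≡i) i-steps))

    rank-corner : ∀ e → e < K → rank (corner (other s) (advance e c)) ≡ width + e
    rank-corner zero _ = begin
      rank (corner (other s) c)   ≡⟨ rank-level c-steps _ ⟩
      depth s c (end (other s) c) ≡⟨ depth-other-end s c ⟩
      width                       ≡⟨ +-identityʳ width ⟨
      width + 0                   ∎
    rank-corner (suc e) e<K = begin
      rank (corner (other s) b)                           ≡⟨ rank-level (steps-advance c e<K) _ ⟩
      width + suc e + depth (other s) b (end (other s) b) ≡⟨ cong (width + suc e +_) (depth-end (other s) b) ⟩
      width + suc e + 0                                   ≡⟨ +-identityʳ (width + suc e) ⟩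
      width + suc e                                       ∎
      where b = advance (suc e) c

    body : Path (corner s c) (corner (other (other s)) i)
    body = crossing s c ◅◅ around (other s) i ◅◅ crossing (other s) i

    arcs-body : arcs body ≡ arcs (crossing s c) ++ arcs (around (other s) i) ++ arcs (crossing (other s) i)
    arcs-body = trans (arcs-◅◅ (crossing s c) _) (cong (arcs (crossing s c) ++_) (arcs-◅◅ (around (other s) i) _))

    body-ascending : Ascending rank body
    body-ascending = subst (All (Ascends rank)) (sym arcs-body)
      (++⁺ (All.tabulate first) (++⁺ (All.tabulate middle) (All.tabulate last)))
      where
      first : ∀ {x} → x ∈ arcs (crossing s c) → Ascends rank x
      first x∈ with ∈-crossing⁻ s c x∈
      ... | j , refl = rung-ascends s j rank 0 (rank-level c-steps)
      middle : ∀ {x} → x ∈ arcs (around (other s) i) → Ascends rank x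
      middle x∈ with ∈-around⁻ (other s) i x∈
      ... | d , d<m , refl = subst₂ _<_
        (sym (trans (cong rank (tl-link (other s))) (rank-corner d (m<n⇒m<1+n d<m))))
        (sym (trans (cong rank (hd-link (other s))) (rank-corner (suc d) (s≤s d<m))))
        (+-monoʳ-< width (n<1+n d))
      last : ∀ {x} → x ∈ arcs (crossing (other s) i) → Ascends rank x
      last x∈ with ∈-crossing⁻ (other s) i x∈
      ... | j , refl = rung-ascends (other s) j rank (width + suc m) (rank-level i-steps)

    closing : Step (corner (other (other s)) i) (corner s c)
    closing = link s i , trans (tl-link s) (cong (λ s′ → corner s′ i) (sym (other-involutive s))) , hd-link s

    detour : Dicycle K p
    detour = toDicycle rank closing body body-ascending

    data DetourArc (x : Arc K p) : Set where
      closing-link : x ≡ link s i → DetourArc x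
      first-rung : ∀ j → x ≡ rung s c j → DetourArc x
      around-link : ∀ b → x ≡ link (other s) b → DetourArc x
      last-rung : ∀ j → x ≡ rung (other s) i j → DetourArc x

    detour-arc : ∀ {x} → detour ∋ₐ x → DetourArc x
    detour-arc x∈ with ∋-toDicycle⁻ rank closing body body-ascending x∈
    ... | here x≡ = closing-link x≡
    ... | there x∈body with ∈-++⁻ (arcs (crossing s c)) (subst (_ ∈_) arcs-body x∈body)
    ...   | inj₁ x∈first = let (j , x≡) = ∈-crossing⁻ s c x∈first in first-rung j x≡
    ...   | inj₂ x∈rest with ∈-++⁻ (arcs (around (other s) i)) x∈rest
    ...     | inj₁ x∈around = let (_ , _ , x≡) = ∈-around⁻ (other s) i x∈around in around-link _ x≡
    ...     | inj₂ x∈last = let (j , x≡) = ∈-crossing⁻ (other s) i x∈last in last-rung j x≡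

    detour-∋-rung : ∀ j → detour ∋ₐ rung (other s) i j
    detour-∋-rung j = ∋-toDicycle⁺ rank closing body body-ascending (there (subst (rung (other s) i j ∈_) (sym arcs-body)
      (∈-++⁺ʳ (arcs (crossing s c)) (∈-++⁺ʳ (arcs (around (other s) i)) (∈-crossing⁺ (other s) i j)))))

    link-∈-detour : ∀ {b} → detour ∋ₐ link s b → b ≡ i
    link-∈-detour x∈ with detour-arc x∈
    ... | closing-link x≡ = link-injective s x≡
    ... | first-rung _ x≡ = contradiction x≡ (link≢rung s s)
    ... | around-link _ x≡ = contradiction x≡ (link≢other-link s)
    ... | last-rung _ x≡ = contradiction x≡ (link≢rung s (other s))

    rung-∉-detour : ∀ j → ¬ detour ∋ₐ rung s i j
    rung-∉-detour j x∈ with detour-arc x∈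
    ... | closing-link x≡ = link≢rung s s (sym x≡)
    ... | first-rung _ x≡ = c≢i (sym (rung-block s x≡))
    ... | around-link _ x≡ = link≢rung (other s) s (sym x≡)
    ... | last-rung _ x≡ = rung≢other-rung s x≡

  open Detour using (detour)

  pairAtLink : ∀ s i → DicyclePair (link s i)
  pairAtLink s i = meetingOnlyAt (ring s) (detour s i) (i , refl) (zero , refl) common
    where
    common : ∀ {x} → ring s ∋ₐ x → detour s i ∋ₐ x → x ≡ link s i
    common (b , refl) x∈ = cong (link s) (Detour.link-∈-detour s i x∈)

  pairAtRung : ∀ s i j → DicyclePair (rung (other s) i j)
  pairAtRung s i j = digonPair (rung (other s) i j) (rung s i j) (rung-meets s) (rung-returns s) (rung-tails-differ s)
    (detour s i) (Detour.detour-∋-rung s i j) (Detour.rung-∉-detour s i j)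

  dicyclePair : (a : Arc K p) → DicyclePair a
  dicyclePair (top i) = pairAtLink upper i
  dicyclePair (bot i) = pairAtLink lower i
  dicyclePair (inF i j) = pairAtRung lower i j
  dicyclePair (inB i j) = pairAtRung upper i j

lemma6 : (n k : ℕ) → 1 ≤ k → k ≤ n → (p : Fin k → ℕ) → (∀ i → 1 ≤ p i)
         → sum (tabulate p) ≡ n → (a : Arc k p)
         → Σ[ C₁ ∈ Dicycle k p ] Σ[ C₂ ∈ Dicycle k p ]
             (C₁ ∋ₐ a) × (C₂ ∋ₐ a) × ShareOnly C₁ C₂ a
lemma6 _ zero () _ _ _ _ _
lemma6 _ (suc zero) _ _ p p≥1 _ a = OneBlock.dicyclePair p (p zero ∸ 1) (sym (m+[n∸m]≡n (p≥1 zero))) a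
lemma6 _ (suc (suc m)) _ _ p _ _ a = ManyBlocks.dicyclePair m p a
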